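{- Let $v\in V$, $e\in E_v$, and let $z\in\mathcal B_v$ be acceptable (i.e. $C_v(z)=z$) with $z(e)<b(e)$. The following are equivalent: (i) $e$ is interesting for $v$ under $z$; (ii) there is an acceptable $\tilde z\in\mathcal B_v$ such that $\tilde z\succ_v z$ and $\tilde z(e)>z(e)$; (iii) $C_v(z+\mathbf 1^e)\ne z$; (iv) $C_v(z+\mathbf 1^e)$ is either $z+\mathbf 1^e$, or $z+\mathbf 1^e-\mathbf 1^{e'}$ for some $e'\in E_v\setminus\{e\}$.
   Context: $G=(V,E)$ is a finite bipartite graph, $b\in\mathbb Z_+^E$ are capacities. For $v\in V$, $E_v$ is the set of edges incident to $v$ and $\mathcal B_v=\{z\in\mathbb Z_+^{E_v}:z(e)\le b(e)\ \forall e\in E_v\}$. Vector inequalities are componentwise, $\wedge,\vee$ are componentwise min and max, $|z|=\sum_e|z(e)|$, $\mathbf 1^e$ is the unit vector of $e$ in $\mathbb Z^{E_v}$. $C_v:\mathcal B_v\to\mathcal B_v$ is a choice function with $C_v(z)\le z$ satisfying for all $z,z'\in\mathcal B_v$: (A1) $z\ge z'\ge C_v(z)\Rightarrow C_v(z')=C_v(z)$; (A2) $z\ge z'\Rightarrow C_v(z)\wedge z'\le C_v(z')$; (A3) $z\ge z'\Rightarrow|C_v(z)|\ge|C_v(z')|$. $z$ is acceptable if $C_v(z)=z$. For distinct acceptable $z,z'$, $z'\prec_v z$ (equivalently $z\succ_v z'$) means $C_v(z\vee z')=z$. An edge $e\in E_v$ is interesting for $v$ under acceptable $z$ if there is $z'\in\mathcal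 B_v$ with $z'(e)>z(e)$, $z'(e')=z(e')$ for all $e'\ne e$, and $C_v(z')(e)>z(e)$. -}

module Defs where

open import Data.Nat using (ℕ; _+_; _∸_; _≤_; _<_; _⊓_; _⊔_)
open import Data.Fin using (Fin; _≟_)
open import Data.Vec.Functional using (foldr)
open import Data.Product using (Σ; _×_; ∃-syntax)
open import Relation.Nullary using (¬_; yes; no)
open import Relation.Binary.PropositionalEquality using (_≡_; _≗_)

-- Vectors in ℤ₊^{E_v}, where E_v is identified with Fin n.
NVec : ℕ → Set
NVec n = Fin n → ℕ

module _ {n : ℕ} where

  _≤v_ : NVec n → NVec n → Set
  x ≤v y = ∀ i → x i ≤ y i

  _∧v_ : NVec n → NVec n → NVec n
  (x ∧v y) i = x i ⊓ y i

  _∨v_ : NVec n → NVec n → NVec n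
  (x ∨v y) i = x i ⊔ y i

  _+v_ : NVec n → NVec n → NVec n
  (x +v y) i = x i + y i

  _∸v_ : NVec n → NVec n → NVec n
  (x ∸v y) i = x i ∸ y i

  ∣_∣v : NVec n → ℕ
  ∣ x ∣v = foldr _+_ 0 x

  unit : Fin n → NVec n
  unit e i with i ≟ e
  ... | yes _ = 1
  ... | no  _ = 0

  InB : NVec n → NVec n → Set
  InB b z = z ≤v b

-- A choice function C_v : 𝓑_v → 𝓑_v satisfying C_v(z) ≤ z and (A1)-(A3).
-- C is given as a total function on ℤ₊^{E_v}; all requirements (and all
-- uses in the lemma) only concern arguments in 𝓑_v.
record ChoiceFunction (n : ℕ) (b : NVec n) : Set where
  field
    C    : NVec n → NVec n
    C≤   : ∀ z → InB b z → C z ≤v z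
    A1   : ∀ z z′ → InB b z → InB b z′ →
           z′ ≤v z → C z ≤v z′ → C z′ ≗ C z
    A2   : ∀ z z′ → InB b z → InB b z′ →
           z′ ≤v z → (C z ∧v z′) ≤v C z′
    A3   : ∀ z z′ → InB b z → InB b z′ →
           z′ ≤v z → ∣ C z′ ∣v ≤ ∣ C z ∣v

module _ {n : ℕ} {b : NVec n} (CF : ChoiceFunction n b) where
  open ChoiceFunction CF

  Acceptable : NVec n → Set
  Acceptable z = InB b z × C z ≗ z

  _≻_ : NVec n → NVec n → Set
  z ≻ z′ = Acceptable z × Acceptable z′ × ¬ (z ≗ z′) × C (z ∨v z′) ≗ z

  Interesting : Fin n → NVec n → Set
  Interesting e z =
    ∃[ z′ ] (InB b z′ × z e < z′ e
             × (∀ e′ → ¬ (e′ ≡ e) → z′ e′ ≡ z e′)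
             × z e < C z′ e)

-- All four conditions are equivalent to "C(z + 1^e) keeps the added copy of e", i.e.
-- z(e) < C(z + 1^e)(e). By substitutability (A2), any larger offer whose choice contains the
-- extra copy forces this, and conversely C(z + 1^e) itself witnesses (i) and (ii). If the
-- extra copy is rejected then C(z + 1^e) ≤ z, so (A1) gives C(z + 1^e) = C(z) = z. If it is
-- kept, size monotonicity (A3) gives |C(z + 1^e)| ≥ |z| = |z + 1^e| - 1, so at most one
-- other unit is dropped.
module Submission where

open import Defs
open import Data.Nat using (ℕ; zero; suc; _<_; _≤_; _+_; _∸_; s≤s; z≤n; _<?_; _≟_)
open import Data.Nat.Properties
open import Data.Fin using (Fin; zero; suc) renaming (_≟_ to _≟ᶠ_)
open import Data.Fin.Properties using (all?; ¬∀⟶∃¬; punchInᵢ≢i)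
open import Data.Vec.Functional using (removeAt)
open import Data.Product using (_×_; _,_; proj₁; proj₂; ∃-syntax)
open import Data.Sum using (_⊎_; inj₁; inj₂)
open import Function.Base using (_∘_)
open import Function.Bundles using (_⇔_; mk⇔)
open import Function.Construct.Composition using (_⇔-∘_)
open import Function.Construct.Symmetry using (⇔-sym)
open import Relation.Nullary using (¬_; yes; no; contradiction)
open import Relation.Nullary.Decidable using (toSum)
open import Relation.Binary.PropositionalEquality using (_≡_; _≢_; _≗_; refl; sym; trans; cong; cong₂; subst; module ≡-Reasoning)
open import Algebra.Properties.CommutativeMonoid.Sum +-0-commutativeMonoid using (sum-cong-≗; ∑-distrib-+; sum-remove; sum-replicate-zero)

unit-self : ∀ {n} (e : Fin n) → unit e e ≡ 1
unit-self e with e ≟ᶠ e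
... | yes _   = refl
... | no e≢e = contradiction refl e≢e

unit-other : ∀ {n} {e i : Fin n} → i ≢ e → unit e i ≡ 0
unit-other {e = e} {i} i≢e with i ≟ᶠ e
... | yes i≡e = contradiction i≡e i≢e
... | no _    = refl

∣unit∣v : ∀ {n} (e : Fin n) → ∣ unit e ∣v ≡ 1
∣unit∣v {suc n} e = begin
  ∣ unit e ∣v                        ≡⟨ sum-remove {i = e} (unit e) ⟩
  unit e e + ∣ removeAt (unit e) e ∣v ≡⟨ cong₂ _+_ (unit-self e) (sum-cong-≗ (unit-other ∘ punchInᵢ≢i e)) ⟩
  1 + ∣ (λ (_ : Fin n) → 0) ∣v        ≡⟨ cong (1 +_) (sum-replicate-zero n) ⟩
  1                                   ∎
  where open ≡-Reasoning

∣+v∣v : ∀ {n} (x y : NVec n) → ∣ x +v y ∣v ≡ ∣ x ∣v + ∣ y ∣v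
∣+v∣v = ∑-distrib-+

∣+v-unit∣v : ∀ {n} (x : NVec n) (e : Fin n) → ∣ x +v unit e ∣v ≡ suc ∣ x ∣v
∣+v-unit∣v x e = begin
  ∣ x +v unit e ∣v       ≡⟨ ∣+v∣v x (unit e) ⟩
  ∣ x ∣v + ∣ unit e ∣v   ≡⟨ cong (∣ x ∣v +_) (∣unit∣v e) ⟩
  ∣ x ∣v + 1             ≡⟨ +-comm ∣ x ∣v 1 ⟩
  suc ∣ x ∣v             ∎
  where open ≡-Reasoning

∣∣v-mono : ∀ {n} {x y : NVec n} → x ≤v y → ∣ x ∣v ≤ ∣ y ∣v
∣∣v-mono {zero}  _   = z≤n
∣∣v-mono {suc n} x≤y = +-mono-≤ (x≤y zero) (∣∣v-mono (x≤y ∘ suc))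

≤v-∣∣v-antisym : ∀ {n} {x y : NVec n} → x ≤v y → ∣ y ∣v ≤ ∣ x ∣v → x ≗ y
≤v-∣∣v-antisym {suc n} {x} {y} x≤y ∣y∣≤∣x∣ = λ where
    zero    → ≤-antisym (x≤y zero) head≥
    (suc i) → ≤v-∣∣v-antisym (x≤y ∘ suc) tail≥ i
  where
  head≥ : y zero ≤ x zero
  head≥ = +-cancelʳ-≤ _ _ _ (≤-trans ∣y∣≤∣x∣ (+-monoʳ-≤ (x zero) (∣∣v-mono (x≤y ∘ suc))))
  tail≥ : ∣ y ∘ suc ∣v ≤ ∣ x ∘ suc ∣v
  tail≥ = +-cancelˡ-≤ (y zero) _ _ (≤-trans ∣y∣≤∣x∣ (+-monoˡ-≤ _ (x≤y zero)))

∸v-unit-+v-unit : ∀ {n} {w : NVec n} {e : Fin n} → 0 < w e → (w ∸v unit e) +v unit e ≗ w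
∸v-unit-+v-unit {w = w} {e} 0<we i with toSum (i ≟ᶠ e)
... | inj₁ refl = trans (cong (λ u → w i ∸ u + u) (unit-self i)) (m∸n+n≡m 0<we)
... | inj₂ i≢e  = trans (cong (λ u → w i ∸ u + u) (unit-other i≢e)) (+-identityʳ (w i))

≗-∸v-unit : ∀ {n} {x w : NVec n} {e : Fin n} →
            x ≤v w → x e < w e → ∣ w ∣v ≤ suc ∣ x ∣v → x ≗ (w ∸v unit e)
≗-∸v-unit {x = x} {w} {e} x≤w xe<we ∣w∣≤1+∣x∣ = ≤v-∣∣v-antisym x≤w∸1ᵉ ∣w∸1ᵉ∣≤∣x∣
  where
  x≤w∸1ᵉ : x ≤v (w ∸v unit e)
  x≤w∸1ᵉ i with toSum (i ≟ᶠ e)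
  ... | inj₁ refl = subst (x i ≤_) (cong (w i ∸_) (sym (unit-self i))) (<⇒≤pred xe<we)
  ... | inj₂ i≢e  = subst (x i ≤_) (cong (w i ∸_) (sym (unit-other i≢e))) (x≤w i)
  ∣w∸1ᵉ∣≤∣x∣ : ∣ w ∸v unit e ∣v ≤ ∣ x ∣v
  ∣w∸1ᵉ∣≤∣x∣ = +-cancelʳ-≤ 1 _ _ (begin
    ∣ w ∸v unit e ∣v + 1              ≡⟨ cong (∣ w ∸v unit e ∣v +_) (∣unit∣v e) ⟨
    ∣ w ∸v unit e ∣v + ∣ unit e ∣v    ≡⟨ ∣+v∣v (w ∸v unit e) (unit e) ⟨
    ∣ (w ∸v unit e) +v unit e ∣v      ≡⟨ sum-cong-≗ (∸v-unit-+v-unit {w = w} {e} (<-≤-trans (s≤s z≤n) xe<we)) ⟩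
    ∣ w ∣v                            ≤⟨ ∣w∣≤1+∣x∣ ⟩
    suc ∣ x ∣v                        ≡⟨ +-comm 1 ∣ x ∣v ⟩
    ∣ x ∣v + 1                        ∎)
    where open ≤-Reasoning

module _ {n : ℕ} (z : NVec n) (e : Fin n) where

  +v-unit-self : (z +v unit e) e ≡ suc (z e)
  +v-unit-self = trans (cong (z e +_) (unit-self e)) (+-comm (z e) 1)

  +v-unit-other : ∀ {i} → i ≢ e → (z +v unit e) i ≡ z i
  +v-unit-other {i} i≢e = trans (cong (z i +_) (unit-other i≢e)) (+-identityʳ (z i))

  ≤v-+v-unit : z ≤v (z +v unit e)
  ≤v-+v-unit i = m≤m+n (z i) (unit e i)

  +v-unit-least : ∀ {y} → z ≤v y → z e < y e → (z +v unit e) ≤v y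
  +v-unit-least z≤y ze<ye i with toSum (i ≟ᶠ e)
  ... | inj₁ refl = ≤-trans (≤-reflexive +v-unit-self) ze<ye
  ... | inj₂ i≢e  = ≤-trans (≤-reflexive (+v-unit-other i≢e)) (z≤y i)

  ≤v-+v-unit⇒≤v : ∀ {x} → x ≤v (z +v unit e) → x e ≤ z e → x ≤v z
  ≤v-+v-unit⇒≤v x≤z+1ᵉ xe≤ze i with toSum (i ≟ᶠ e)
  ... | inj₁ refl = xe≤ze
  ... | inj₂ i≢e  = ≤-trans (x≤z+1ᵉ i) (≤-reflexive (+v-unit-other i≢e))

∨v-InB : ∀ {n} {b x y : NVec n} → InB b x → InB b y → InB b (x ∨v y)
∨v-InB xB yB i = ⊔-lub (xB i) (yB i)

module _ {n : ℕ} {b : NVec n} (CF : ChoiceFunction n b) where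
  open ChoiceFunction CF

  C-InB : ∀ {x} → InB b x → InB b (C x)
  C-InB xB i = ≤-trans (C≤ _ xB i) (xB i)

  C-acceptable : ∀ {x} → InB b x → Acceptable CF (C x)
  C-acceptable xB = C-InB xB , A1 _ _ xB (C-InB xB) (C≤ _ xB) (λ _ → ≤-refl)

  C-saturated-below : ∀ {x y i} → InB b y → InB b x → x ≤v y → x i ≤ C y i → x i ≤ C x i
  C-saturated-below {x} {y} {i} yB xB x≤y xi≤Cyi = ≤-trans (⊓-glb xi≤Cyi ≤-refl) (A2 y x yB xB x≤y i)

  module ExtraCopy (e : Fin n) {z : NVec n} (acc : Acceptable CF z) (ze<be : z e < b e) where

    zB : InB b z
    zB = proj₁ acc

    w : NVec n
    w = z +v unit e

    wB : InB b w
    wB = +v-unit-least z e zB ze<be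

    w-self : w e ≡ suc (z e)
    w-self = +v-unit-self z e

    z≤w : z ≤v w
    z≤w = ≤v-+v-unit z e

    ExtraCopyChosen : Set
    ExtraCopyChosen = z e < C w e

    chosen-from-above : ∀ {y} → InB b y → w ≤v y → z e < C y e → ExtraCopyChosen
    chosen-from-above {y} yB w≤y ze<Cye =
      subst (_≤ C w e) w-self
        (C-saturated-below yB wB w≤y (subst (_≤ C y e) (sym w-self) ze<Cye))

    chosen⇒C≉z : ExtraCopyChosen → ¬ (C w ≗ z)
    chosen⇒C≉z chosen Cw≗z = <-irrefl (sym (Cw≗z e)) chosen

    interesting⇔chosen : Interesting CF e z ⇔ ExtraCopyChosen
    interesting⇔chosen = mk⇔ to from
      where
      to : Interesting CF e z → ExtraCopyChosen
      to (z′ , z′B , ze<z′e , agree , ze<Cz′e) =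
        chosen-from-above z′B (+v-unit-least z e z≤z′ ze<z′e) ze<Cz′e
        where
        z≤z′ : z ≤v z′
        z≤z′ i with toSum (i ≟ᶠ e)
        ... | inj₁ refl = <⇒≤ ze<z′e
        ... | inj₂ i≢e  = ≤-reflexive (sym (agree i i≢e))
      from : ExtraCopyChosen → Interesting CF e z
      from chosen = w , wB , ≤-reflexive (sym w-self) , (λ _ → +v-unit-other z e) , chosen

    improvement⇔chosen : (∃[ z̃ ] (Acceptable CF z̃ × _≻_ CF z̃ z × z e < z̃ e)) ⇔ ExtraCopyChosen
    improvement⇔chosen = mk⇔ to from
      where
      to : ∃[ z̃ ] (Acceptable CF z̃ × _≻_ CF z̃ z × z e < z̃ e) → ExtraCopyChosen
      to (z̃ , (z̃B , _) , (_ , _ , _ , C[z̃∨z]≗z̃) , ze<z̃e) =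
        chosen-from-above (∨v-InB z̃B zB)
          (+v-unit-least z e (λ i → m≤n⊔m (z̃ i) (z i)) (<-≤-trans ze<z̃e (m≤m⊔n (z̃ e) (z e))))
          (subst (z e <_) (sym (C[z̃∨z]≗z̃ e)) ze<z̃e)
      -- C(z + 1^e) ≥ C(z + 1^e) ∨ z ≥ C(z + 1^e), so (A1) makes C(z + 1^e) the choice from the join.
      from : ExtraCopyChosen → ∃[ z̃ ] (Acceptable CF z̃ × _≻_ CF z̃ z × z e < z̃ e)
      from chosen =
        C w , C-acceptable wB ,
        (C-acceptable wB , acc , chosen⇒C≉z chosen ,
         A1 w (C w ∨v z) wB (∨v-InB (C-InB wB) zB)
           (λ i → ⊔-lub (C≤ w wB i) (z≤w i)) (λ i → m≤m⊔n (C w i) (z i))) ,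
        chosen

    C≉z⇔chosen : (¬ (C w ≗ z)) ⇔ ExtraCopyChosen
    C≉z⇔chosen = mk⇔ to chosen⇒C≉z
      where
      to : ¬ (C w ≗ z) → ExtraCopyChosen
      to Cw≉z with z e <? C w e
      ... | yes chosen     = chosen
      ... | no not-chosen = contradiction (λ i → trans (sym (A1 w z wB zB z≤w Cw≤z i)) (proj₂ acc i)) Cw≉z
        where
        Cw≤z : C w ≤v z
        Cw≤z = ≤v-+v-unit⇒≤v z e (C≤ w wB) (≮⇒≥ not-chosen)

    at-most-one-dropped⇔chosen :
      (C w ≗ w ⊎ ∃[ e′ ] (e′ ≢ e × C w ≗ (w ∸v unit e′))) ⇔ ExtraCopyChosen
    at-most-one-dropped⇔chosen = mk⇔ to from
      where
      to : C w ≗ w ⊎ ∃[ e′ ] (e′ ≢ e × C w ≗ (w ∸v unit e′)) → ExtraCopyChosen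
      to (inj₁ Cw≗w) = ≤-reflexive (sym (trans (Cw≗w e) w-self))
      to (inj₂ (e′ , e′≢e , Cw≗w∸1ᵉ′)) =
        ≤-reflexive (sym (trans (Cw≗w∸1ᵉ′ e) (trans (cong (w e ∸_) (unit-other (e′≢e ∘ sym))) w-self)))
      from : ExtraCopyChosen → C w ≗ w ⊎ ∃[ e′ ] (e′ ≢ e × C w ≗ (w ∸v unit e′))
      from chosen with all? (λ i → C w i ≟ w i)
      ... | yes Cw≗w = inj₁ Cw≗w
      ... | no Cw≉w with ¬∀⟶∃¬ n _ (λ i → C w i ≟ w i) Cw≉w
      ... | e′ , Cwe′≢we′ =
        inj₂ (e′ , e′≢e , ≗-∸v-unit (C≤ w wB) (≤∧≢⇒< (C≤ w wB e′) Cwe′≢we′) ∣w∣≤1+∣Cw∣)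
        where
        e′≢e : e′ ≢ e
        e′≢e refl = Cwe′≢we′ (≤-antisym (C≤ w wB e) (subst (_≤ C w e) (sym w-self) chosen))
        ∣w∣≤1+∣Cw∣ : ∣ w ∣v ≤ suc ∣ C w ∣v
        ∣w∣≤1+∣Cw∣ = begin
          ∣ w ∣v        ≡⟨ ∣+v-unit∣v z e ⟩
          suc ∣ z ∣v    ≡⟨ cong suc (sum-cong-≗ (proj₂ acc)) ⟨
          suc ∣ C z ∣v  ≤⟨ s≤s (A3 w z wB zB z≤w) ⟩
          suc ∣ C w ∣v  ∎
          where open ≤-Reasoning

lemma3p1 : (n : ℕ) (b : NVec n) (CF : ChoiceFunction n b) (e : Fin n) (z : NVec n) →
    Acceptable CF z → z e < b e →
    let C = ChoiceFunction.C CF in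
    (Interesting CF e z ⇔ (∃[ z̃ ] (Acceptable CF z̃ × _≻_ CF z̃ z × z e < z̃ e)))
    × (Interesting CF e z ⇔ (¬ (C (z +v unit e) ≗ z)))
    × (Interesting CF e z ⇔
        (C (z +v unit e) ≗ (z +v unit e)
         ⊎ ∃[ e′ ] (¬ (e′ ≡ e) × C (z +v unit e) ≗ ((z +v unit e) ∸v unit e′))))
lemma3p1 n b CF e z acc ze<be =
  ⇔-sym improvement⇔chosen ⇔-∘ interesting⇔chosen ,
  ⇔-sym C≉z⇔chosen ⇔-∘ interesting⇔chosen ,
  ⇔-sym at-most-one-dropped⇔chosen ⇔-∘ interesting⇔chosen
  where open ExtraCopy CF e acc ze<be
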